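{- Let $G$ be a 2-connected outerplanar graph with outer cycle $F$, and let $v$ be a vertex of $G$. Suppose that $G$ has an ear $H=(u_1,u_2,\dots,u_r)$, with vertices appearing in this order along $F$ and root edge $u_1u_r$, such that $v\notin V(H)\setminus\{u_1\}$. Let $\varphi$ be a proper 4-coloring of a subgraph of $G-(V(H)\setminus\{u_1,u_r\})$ in which $u_1$, $u_r$, and all neighbors of $u_1$ in $G-(V(H)\setminus\{u_1,u_r\})$ are colored. Then $\varphi$ can be extended to a proper 4-coloring of $H$ (i.e. by coloring $u_2,\dots,u_{r-1}$) so that every vertex of $V(H)\setminus\{u_r\}$ satisfies the parity condition.
   Context: All graphs are simple and finite; $d_G(x)$ is the degree of $x$ in $G$. An ear of $G$ is a cycle $(u_1,\dots,u_r)$ in $G$ with $d_G(u_i)=2$ for all $i\in\{2,\dots,r-1\}$; its root edge is $u_1u_r$. For a (partial) proper coloring $\varphi$ with colors in $\{1,2,3,4\}$, a vertex $x$ satisfies the odd condition if $|\varphi^{ -1}(i)\cap N_G(x)|$ is odd for some color $i$, and the even condition if $|\varphi^{ -1}(i)\cap N_G(x)|$ is even (possibly zero) for some color $i\neq\varphi(x)$. A vertex $x$ satisfies the parity condition if $x$ satisfies the odd condition and, in case $x=v$, $x$ also satisfies the even condition. -}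

module Defs where

open import Data.Nat using (ℕ; zero; suc; _+_; _<_; _≤_; _%_)
open import Data.Fin using (Fin; toℕ; fromℕ) renaming (zero to fzero)
open import Data.Fin.Properties using () renaming (_≟_ to _≟F_)
open import Data.Bool using (Bool; true; false; _∧_; if_then_else_)
open import Data.Maybe using (Maybe; just; nothing)
open import Data.List using (List; map; allFin)
open import Data.Nat.ListAction using (sum)
open import Data.Product using (Σ; ∃; _×_; _,_)
open import Relation.Nullary using (¬_; does)
open import Relation.Binary.PropositionalEquality using (_≡_; _≢_)
open import Function.Definitions using (Injective)

record SimpleGraph (n : ℕ) : Set where
  field
    adj   : Fin n → Fin n → Bool
    sym   : ∀ x y → adj x y ≡ adj y x
    irefl : ∀ x → adj x x ≡ false

open SimpleGraph public

_∼_ : ∀ {n} → SimpleGraph n → Fin n → Fin n → Set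
(G ∼ x) y = adj G x y ≡ true

countB : ∀ {n} → (Fin n → Bool) → ℕ
countB p = sum (map (λ y → if p y then 1 else 0) (allFin _))

deg : ∀ {n} → SimpleGraph n → Fin n → ℕ
deg G x = countB (adj G x)

-- partial 4-colorings: nothing = uncolored
Coloring : ℕ → Set
Coloring n = Fin n → Maybe (Fin 4)

hasColor : Maybe (Fin 4) → Fin 4 → Bool
hasColor nothing  c = false
hasColor (just d) c = does (d ≟F c)

Proper : ∀ {n} → SimpleGraph n → Coloring n → Set
Proper G φ = ∀ x y c → (G ∼ x) y → φ x ≡ just c → φ y ≢ just c

nbrCount : ∀ {n} → SimpleGraph n → Coloring n → Fin n → Fin 4 → ℕ
nbrCount G φ x i = countB (λ y → adj G x y ∧ hasColor (φ y) i)

OddCond : ∀ {n} → SimpleGraph n → Coloring n → Fin n → Set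
OddCond G φ x = ∃ λ (i : Fin 4) → nbrCount G φ x i % 2 ≡ 1

EvenCond : ∀ {n} → SimpleGraph n → Coloring n → Fin n → Set
EvenCond G φ x = ∃ λ (i : Fin 4) → φ x ≢ just i × nbrCount G φ x i % 2 ≡ 0

ParityCond : ∀ {n} → SimpleGraph n → Coloring n → Fin n → Fin n → Set
ParityCond G φ v x = OddCond G φ x × (x ≡ v → EvenCond G φ x)

-- Outer cycle.  pos : Fin n → Fin n is injective (so a bijection) and
-- gives the position of each vertex along the cycle F; F visits the
-- vertices in order of positions 0,1,...,n-1 and then back to 0.

FNext : ∀ {n} → (Fin n → Fin n) → Fin n → Fin n → Set
FNext {n} pos x y = (suc (toℕ (pos x)) ≡ toℕ (pos y))
                  ⊎' (suc (toℕ (pos x)) ≡ n × toℕ (pos y) ≡ 0)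
  where
  open import Data.Sum using () renaming (_⊎_ to _⊎'_)

-- G is a 2-connected outerplanar graph with outer cycle F (given by pos):
-- F is a Hamiltonian cycle of G (n ≥ 3) and no two chords cross, i.e.
-- G is drawn with all vertices on F as the boundary of the outer face.
record OuterplanarWithOuterCycle {n} (G : SimpleGraph n) (pos : Fin n → Fin n) : Set where
  field
    atLeast3   : 3 ≤ n
    posInj     : Injective _≡_ _≡_ pos
    cycleEdges : ∀ x y → FNext pos x y → (G ∼ x) y
    noCrossing : ∀ a b c d →
                 toℕ (pos a) < toℕ (pos c) → toℕ (pos c) < toℕ (pos b) →
                 toℕ (pos b) < toℕ (pos d) →
                 ¬ ((G ∼ a) b × (G ∼ c) d)

-- Ears.  H = (u_1,...,u_r) with r = suc m, indexed u : Fin (suc m) → Fin n,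
-- u_1 = u fzero, u_r = u (fromℕ m); root edge u_1 u_r.

Consec : ∀ {r} → Fin r → Fin r → Set
Consec i j = toℕ j ≡ suc (toℕ i)

record Ear {n} (G : SimpleGraph n) (m : ℕ) (u : Fin (suc m) → Fin n) : Set where
  field
    length≥3  : 2 ≤ m
    distinct  : Injective _≡_ _≡_ u
    pathEdges : ∀ i j → Consec i j → (G ∼ u i) (u j)
    rootEdge  : (G ∼ u fzero) (u (fromℕ m))
    innerDeg2 : ∀ i → toℕ i ≢ 0 → toℕ i ≢ m → deg G (u i) ≡ 2

InOrderAlongF : ∀ {n m} → (Fin n → Fin n) → (Fin (suc m) → Fin n) → Set
InOrderAlongF pos u = (∀ i j → Consec i j → FNext pos (u i) (u j))
                    ⊎' (∀ i j → Consec i j → FNext pos (u j) (u i))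
  where
  open import Data.Sum using () renaming (_⊎_ to _⊎'_)

InH : ∀ {n m} → (Fin (suc m) → Fin n) → Fin n → Set
InH u x = ∃ λ i → u i ≡ x

Inner : ∀ {n m} → (Fin (suc m) → Fin n) → Fin n → Set
Inner {m = m} u x = ∃ λ i → u i ≡ x × toℕ i ≢ 0 × toℕ i ≢ m

-- Every inner vertex u₂, …, u_{r-1} of the ear has degree 2, so its only neighbours are its
-- two neighbours on H.  Colour u₂ first, choosing among the two colours different from φ(u₁)
-- and φ(u_r) one that makes u₁ satisfy both the odd and the even condition; then colour
-- u₃, …, u_{r-1} greedily, each differently from its two predecessors and from φ(u_r).
-- Then every inner vertex sees two distinct colours on its two neighbours, so the colour of
-- its predecessor occurs exactly once around it.  Since v can only be u₁, the even condition
-- is needed nowhere else.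
module Submission where

open import Defs hiding (sym)
open import Data.Nat as ℕ using (ℕ; zero; suc; _+_; _<_; _≤_; _%_; z≤n; s≤s)
open import Data.Nat.Properties
  using ( ≤∧≢⇒<; <⇒≤; ≤-trans; n≤1+n; <⇒≢; ≤-pred; ≤-refl; n<1+n; m<n⇒m<1+n; m≤n⇒m<n∨m≡n; 1+n≢0
        ; +-commutativeSemigroup)
open import Algebra.Properties.CommutativeSemigroup +-commutativeSemigroup using (x∙yz≈y∙xz)
open import Data.Nat.DivMod using (_mod_; m<n⇒m%n≡m)
open import Data.Fin using (Fin; toℕ; fromℕ; suc) renaming (zero to fzero)
open import Data.Fin.Properties using (_≟_; toℕ<n; toℕ-injective; toℕ-fromℕ; toℕ-fromℕ<; all?; any?)
open import Data.Bool using (Bool; true; false; _∧_; not; if_then_else_)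
open import Data.Bool.Properties using (∧-identityʳ; ∧-zeroʳ)
open import Data.List using (tabulate)
open import Data.List.Properties using (map-tabulate)
open import Data.Nat.ListAction using (sum)
open import Data.Maybe using (Maybe; just; nothing)
open import Data.Maybe.Properties using (just-injective)
open import Data.Product using (∃; _×_; _,_; proj₁; proj₂)
open import Data.Sum using (_⊎_; inj₁; inj₂)
open import Data.Empty using (⊥; ⊥-elim)
open import Function using (_∘_; id)
open import Relation.Nullary using (¬_; Dec; yes; no; does; contradiction)
open import Relation.Nullary.Decidable using (dec-true; dec-false; from-yes; _×-dec_; ¬?)
open import Relation.Unary using (Decidable)
open import Relation.Binary.PropositionalEquality
  using (_≡_; _≢_; refl; sym; trans; cong; cong₂; subst; ≢-sym; module ≡-Reasoning)

𝟙 : Bool → ℕ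
𝟙 b = if b then 1 else 0

infixl 5 _∖_
_∖_ : ∀ {n} → (Fin n → Bool) → Fin n → Fin n → Bool
(p ∖ a) y = p y ∧ not (does (y ≟ a))

countB-suc : ∀ {n} (p : Fin (suc n) → Bool) → countB p ≡ 𝟙 (p fzero) + countB (p ∘ suc)
countB-suc p = trans (countB-tabulate p) (cong (𝟙 (p fzero) +_) (sym (countB-tabulate (p ∘ suc))))
  where
  countB-tabulate : ∀ {n} (q : Fin n → Bool) → countB q ≡ sum (tabulate (𝟙 ∘ q))
  countB-tabulate q = cong sum (map-tabulate id (𝟙 ∘ q))

countB-cong : ∀ {n} {p q : Fin n → Bool} → (∀ y → p y ≡ q y) → countB p ≡ countB q
countB-cong {zero}  p≗q = refl
countB-cong {suc n} {p} {q} p≗q = begin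
  countB p                          ≡⟨ countB-suc p ⟩
  𝟙 (p fzero) + countB (p ∘ suc)    ≡⟨ cong₂ _+_ (cong 𝟙 (p≗q fzero)) (countB-cong (p≗q ∘ suc)) ⟩
  𝟙 (q fzero) + countB (q ∘ suc)    ≡⟨ sym (countB-suc q) ⟩
  countB q                          ∎
  where open ≡-Reasoning

countB-remove : ∀ {n} (p : Fin n → Bool) (a : Fin n) → countB p ≡ 𝟙 (p a) + countB (p ∖ a)
countB-remove p fzero = trans (countB-suc p) (cong (𝟙 (p fzero) +_) (sym (begin
  countB (p ∖ fzero)                                     ≡⟨ countB-suc (p ∖ fzero) ⟩
  𝟙 (p fzero ∧ false) + countB (λ y → p (suc y) ∧ true) ≡⟨ cong₂ _+_ (cong 𝟙 (∧-zeroʳ (p fzero)))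
                                                                     (countB-cong (∧-identityʳ ∘ p ∘ suc)) ⟩
  countB (p ∘ suc)                                       ∎)))
  where open ≡-Reasoning
countB-remove p (suc a) = begin
  countB p                                       ≡⟨ countB-suc p ⟩
  𝟙 (p fzero) + countB (p ∘ suc)                 ≡⟨ cong (𝟙 (p fzero) +_) (countB-remove (p ∘ suc) a) ⟩
  𝟙 (p fzero) + (𝟙 (p (suc a)) + countB rest)   ≡⟨ x∙yz≈y∙xz (𝟙 (p fzero)) (𝟙 (p (suc a))) (countB rest) ⟩
  𝟙 (p (suc a)) + (𝟙 (p fzero) + countB rest)   ≡⟨ cong (λ b → 𝟙 (p (suc a)) + (𝟙 b + countB rest))
                                                          (sym (∧-identityʳ (p fzero))) ⟩
  𝟙 (p (suc a)) + (𝟙 ((p ∖ suc a) fzero) + countB rest)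
                                                 ≡⟨ cong (𝟙 (p (suc a)) +_) (sym (countB-suc (p ∖ suc a))) ⟩
  𝟙 (p (suc a)) + countB (p ∖ suc a)             ∎
  where
  open ≡-Reasoning
  rest : Fin _ → Bool
  rest = (p ∘ suc) ∖ a

∖-≢ : ∀ {n} (p : Fin n → Bool) {a y : Fin n} → y ≢ a → (p ∖ a) y ≡ p y
∖-≢ p {a} {y} y≢a rewrite dec-false (y ≟ a) y≢a = ∧-identityʳ (p y)

countB-remove-true : ∀ {n} (p : Fin n → Bool) {a} → p a ≡ true → countB p ≡ suc (countB (p ∖ a))
countB-remove-true p {a} pa = trans (countB-remove p a) (cong (λ b → 𝟙 b + countB (p ∖ a)) pa)

countB-false : ∀ {n} {p : Fin n → Bool} → (∀ y → p y ≡ false) → countB p ≡ 0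
countB-false {zero}  _ = refl
countB-false {suc n} {p} p≗false =
  trans (countB-suc p) (cong₂ _+_ (cong 𝟙 (p≗false fzero)) (countB-false (p≗false ∘ suc)))

countB-singleton : ∀ {n} (p : Fin n → Bool) {a} →
                   p a ≡ true → (∀ y → p y ≡ true → y ≡ a) → countB p ≡ 1
countB-singleton p {a} pa only = trans (countB-remove-true p pa) (cong suc (countB-false removed))
  where
  removed : ∀ y → (p ∖ a) y ≡ false
  removed y with p y in py
  ... | false = refl
  ... | true  = cong not (dec-true (y ≟ a) (only y py))

countB≡2⇒≡⊎≡ : ∀ {n} (p : Fin n → Bool) {a b y} →
  countB p ≡ 2 → p a ≡ true → p b ≡ true → a ≢ b → p y ≡ true → y ≡ a ⊎ y ≡ b
countB≡2⇒≡⊎≡ p {a} {b} {y} two pa pb a≢b py with y ≟ a | y ≟ b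
... | yes y≡a | _       = inj₁ y≡a
... | no _    | yes y≡b = inj₂ y≡b
... | no y≢a  | no y≢b  = contradiction (trans (sym three) two) λ ()
  where
  three : countB p ≡ 3 + countB (p ∖ a ∖ b ∖ y)
  three = trans (countB-remove-true p pa) (cong suc
          (trans (countB-remove-true (p ∖ a) (trans (∖-≢ p (≢-sym a≢b)) pb)) (cong suc
          (countB-remove-true (p ∖ a ∖ b) (trans (∖-≢ (p ∖ a) y≢b) (trans (∖-≢ p y≢a) py))))))

∧≡true : ∀ {x y} → x ∧ y ≡ true → x ≡ true × y ≡ true
∧≡true {true} {true} refl = refl , refl

hasColor≡true : ∀ {c k} → hasColor c k ≡ true → c ≡ just k
hasColor≡true {just d} {k} with d ≟ k
... | yes refl = λ _ → refl

∼-sym : ∀ {n} (G : SimpleGraph n) {x y} → (G ∼ x) y → (G ∼ y) x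
∼-sym G {x} {y} x∼y = trans (SimpleGraph.sym G y x) x∼y

addColour : Fin 4 → (Fin 4 → ℕ) → Fin 4 → ℕ
addColour c A k = 𝟙 (does (c ≟ k)) + A k

addColour-same : ∀ c A → addColour c A c ≡ suc (A c)
addColour-same c A rewrite dec-true (c ≟ c) refl = refl

addColour-other : ∀ {c k} A → c ≢ k → addColour c A k ≡ A k
addColour-other {c} {k} A c≢k rewrite dec-false (c ≟ k) c≢k = refl

module _ {n} (G : SimpleGraph n) (φ : Coloring n) {x a : Fin n} {k : Fin 4} where

  nbrCount≡1 : ∀ {b} → (∀ y → (G ∼ x) y → y ≡ a ⊎ y ≡ b) → (G ∼ x) a →
               φ a ≡ just k → φ b ≢ just k → nbrCount G φ x k ≡ 1
  nbrCount≡1 {b} nbrs x∼a φa φb≢k = countB-singleton _ a-counted only-a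
    where
    a-counted : adj G x a ∧ hasColor (φ a) k ≡ true
    a-counted rewrite x∼a | φa = dec-true (k ≟ k) refl
    only-a : ∀ y → adj G x y ∧ hasColor (φ y) k ≡ true → y ≡ a
    only-a y counted with ∧≡true counted
    ... | x∼y , φy with nbrs y x∼y
    ...   | inj₁ y≡a = y≡a
    ...   | inj₂ refl = contradiction (hasColor≡true φy) φb≢k

  nbrCount-fill : ∀ {ψ : Coloring n} {c} → (G ∼ x) a → φ a ≡ nothing → ψ a ≡ just c →
                  (∀ y → y ≢ a → (G ∼ x) y → ψ y ≡ φ y) →
                  nbrCount G ψ x k ≡ addColour c (nbrCount G φ x) k
  nbrCount-fill {ψ} {c} x∼a φa ψa ψ≗φ = begin
    nbrCount G ψ x k                          ≡⟨ countB-remove (counted ψ) a ⟩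
    𝟙 (counted ψ a) + countB (counted ψ ∖ a)  ≡⟨ cong₂ _+_ (cong 𝟙 ψa-counted) (countB-cong same) ⟩
    𝟙 (does (c ≟ k)) + countB (counted φ ∖ a) ≡⟨ cong (𝟙 (does (c ≟ k)) +_) (sym φ-side) ⟩
    addColour c (nbrCount G φ x) k            ∎
    where
    open ≡-Reasoning
    counted : Coloring n → Fin n → Bool
    counted χ y = adj G x y ∧ hasColor (χ y) k
    ψa-counted : counted ψ a ≡ does (c ≟ k)
    ψa-counted rewrite x∼a | ψa = refl
    φ-side : nbrCount G φ x k ≡ countB (counted φ ∖ a)
    φ-side rewrite countB-remove (counted φ) a | φa =
      cong (λ b → 𝟙 b + countB (counted φ ∖ a)) (∧-zeroʳ (adj G x a))
    same : ∀ y → (counted ψ ∖ a) y ≡ (counted φ ∖ a) y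
    same y with y ≟ a
    ... | yes _ = trans (∧-zeroʳ (counted ψ y)) (sym (∧-zeroʳ (counted φ y)))
    ... | no y≢a with adj G x y in x∼y
    ...   | false = refl
    ...   | true  = cong (λ χy → hasColor χy k ∧ true) (ψ≗φ y y≢a x∼y)

n%2≡0⊎n%2≡1 : ∀ n → n % 2 ≡ 0 ⊎ n % 2 ≡ 1
n%2≡0⊎n%2≡1 0 = inj₁ refl
n%2≡0⊎n%2≡1 1 = inj₂ refl
n%2≡0⊎n%2≡1 (suc (suc n)) = n%2≡0⊎n%2≡1 n

even⇒suc-odd : ∀ n → n % 2 ≡ 0 → suc n % 2 ≡ 1
even⇒suc-odd 0 _ = refl
even⇒suc-odd (suc (suc n)) = even⇒suc-odd n

odd⇒suc-even : ∀ n → n % 2 ≡ 1 → suc n % 2 ≡ 0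
odd⇒suc-even 1 _ = refl
odd⇒suc-even (suc (suc n)) = odd⇒suc-even n

-- Opaque, since otherwise with-abstraction over fresh unfolds the whole exhaustive search.
opaque
  fresh : (a b c : Fin 4) → ∃ λ d → d ≢ a × d ≢ b × d ≢ c
  fresh = from-yes (all? λ (a : Fin 4) → all? λ (b : Fin 4) → all? λ (c : Fin 4) →
                    any? λ (d : Fin 4) → ¬? (d ≟ a) ×-dec ¬? (d ≟ b) ×-dec ¬? (d ≟ c))

-- A k counts the neighbours of u₁ of colour k before u₂ is coloured; c₁ is a good colour for u₂.
RootColour : (c₀ t : Fin 4) (A : Fin 4 → ℕ) → Fin 4 → Set
RootColour c₀ t A c₁ = c₁ ≢ c₀ × c₁ ≢ t
  × (∃ λ k → addColour c₁ A k % 2 ≡ 1)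
  × (∃ λ k → k ≢ c₀ × addColour c₁ A k % 2 ≡ 0)

module _ (A : Fin 4 → ℕ) where

  private
    same : ∀ c {r} → suc (A c) % 2 ≡ r → addColour c A c % 2 ≡ r
    same c = trans (cong (_% 2) (addColour-same c A))

    other : ∀ {c k r} → c ≢ k → A k % 2 ≡ r → addColour c A k % 2 ≡ r
    other c≢k = trans (cong (_% 2) (addColour-other A c≢k))

  -- q and s are the two colours other than c₀ and t.  If A t is even, t witnesses the even
  -- condition and the colour of u₂ is chosen to create an odd count; if A t is odd, vice versa.
  root-colour : (c₀ t : Fin 4) → c₀ ≢ t → ∃ (RootColour c₀ t A)
  root-colour c₀ t c₀≢t with fresh c₀ t t
  ... | q , q≢c₀ , q≢t , _ with fresh c₀ t q
  ... | s , s≢c₀ , s≢t , s≢q with n%2≡0⊎n%2≡1 (A t) | n%2≡0⊎n%2≡1 (A q) | n%2≡0⊎n%2≡1 (A s)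
  ... | inj₁ t-even | inj₁ q-even | _ =
    q , q≢c₀ , q≢t , (q , same q (even⇒suc-odd (A q) q-even)) , (t , ≢-sym c₀≢t , other q≢t t-even)
  ... | inj₁ t-even | inj₂ q-odd | _ =
    s , s≢c₀ , s≢t , (q , other s≢q q-odd) , (t , ≢-sym c₀≢t , other s≢t t-even)
  ... | inj₂ t-odd | _ | inj₁ s-even =
    q , q≢c₀ , q≢t , (t , other q≢t t-odd) , (s , s≢c₀ , other (≢-sym s≢q) s-even)
  ... | inj₂ t-odd | _ | inj₂ s-odd =
    s , s≢c₀ , s≢t , (t , other s≢t t-odd) , (s , s≢c₀ , same s (odd⇒suc-even (A s) s-odd))

module PathColouring {c₀ c₁ t : Fin 4} (c₀≢t : c₀ ≢ t) (c₁≢c₀ : c₁ ≢ c₀) (c₁≢t : c₁ ≢ t) where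

  colour : ℕ → Fin 4
  colour 0 = c₀
  colour 1 = c₁
  colour (suc (suc j)) = proj₁ (fresh (colour j) (colour (suc j)) t)

  colour≢t : ∀ j → colour j ≢ t
  colour≢t 0 = c₀≢t
  colour≢t 1 = c₁≢t
  colour≢t (suc (suc j)) = proj₂ (proj₂ (proj₂ (fresh (colour j) (colour (suc j)) t)))

  colour≢previous : ∀ j → colour (suc j) ≢ colour j
  colour≢previous 0 = c₁≢c₀
  colour≢previous (suc j) = proj₁ (proj₂ (proj₂ (fresh (colour j) (colour (suc j)) t)))

  colour≢previous² : ∀ j → colour (suc (suc j)) ≢ colour j
  colour≢previous² j = proj₁ (proj₂ (fresh (colour j) (colour (suc j)) t))

module EarPath {n m} {G : SimpleGraph n} {u : Fin (suc m) → Fin n} (ear : Ear G m u) where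
  open Ear ear

  -- U j is the vertex u_{j+1} of the paper; j mod suc m merely makes U total, it is only
  -- ever used for j ≤ m.
  U : ℕ → Fin n
  U j = u (j mod suc m)

  toℕ-mod : ∀ {j} → j ≤ m → toℕ (j mod suc m) ≡ j
  toℕ-mod j≤m = trans (toℕ-fromℕ< _) (m<n⇒m%n≡m (s≤s j≤m))

  U-toℕ : ∀ i → U (toℕ i) ≡ u i
  U-toℕ i = cong u (toℕ-injective (toℕ-mod (≤-pred (toℕ<n i))))

  U-last : U m ≡ u (fromℕ m)
  U-last = subst (λ j → U j ≡ u (fromℕ m)) (toℕ-fromℕ m) (U-toℕ (fromℕ m))

  U-injective : ∀ {j k} → j ≤ m → k ≤ m → U j ≡ U k → j ≡ k
  U-injective j≤m k≤m Uj≡Uk =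
    trans (sym (toℕ-mod j≤m)) (trans (cong toℕ (distinct Uj≡Uk)) (toℕ-mod k≤m))

  U-adjacent : ∀ {j} → suc j ≤ m → (G ∼ U j) (U (suc j))
  U-adjacent j<m = pathEdges _ _ (trans (toℕ-mod j<m) (cong suc (sym (toℕ-mod (<⇒≤ j<m)))))

  U-inner : ∀ {j} → suc j < m → Inner u (U (suc j))
  U-inner j+1<m = _ , refl , 1+n≢0 ∘ trans (sym index) , <⇒≢ j+1<m ∘ trans (sym index)
    where index = toℕ-mod (<⇒≤ j+1<m)

  inner-index : ∀ {x} → Inner u x → ∃ λ j → suc j < m × U (suc j) ≡ x
  inner-index (fzero  , _    , i≢0 , _)   = ⊥-elim (i≢0 refl)
  inner-index (suc i  , refl , _   , i≢m) = toℕ i , ≤∧≢⇒< (≤-pred (toℕ<n (suc i))) i≢m , U-toℕ (suc i)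

  ¬inner-first : ¬ Inner u (U 0)
  ¬inner-first (_ , ui≡u₀ , i≢0 , _) = i≢0 (cong toℕ (distinct ui≡u₀))

  ¬inner-last : ¬ Inner u (U m)
  ¬inner-last (_ , ui≡uₘ , _ , i≢m) = i≢m (trans (cong toℕ (distinct ui≡uₘ)) (toℕ-mod ≤-refl))

  inner? : Decidable (Inner u)
  inner? x = any? λ i → (u i ≟ x) ×-dec ¬? (toℕ i ℕ.≟ 0) ×-dec ¬? (toℕ i ℕ.≟ m)

  inner-neighbours : ∀ {j y} → suc j < m → (G ∼ U (suc j)) y → y ≡ U j ⊎ y ≡ U (suc (suc j))
  inner-neighbours {j} j+1<m =
    countB≡2⇒≡⊎≡ _ (inner-degree (U-inner j+1<m)) (∼-sym G (U-adjacent (<⇒≤ j+1<m))) (U-adjacent j+1<m)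
      (<⇒≢ (m<n⇒m<1+n (n<1+n j)) ∘ U-injective (≤-trans (n≤1+n j) (<⇒≤ j+1<m)) j+1<m)
    where
    inner-degree : ∀ {x} → Inner u x → deg G x ≡ 2
    inner-degree (i , refl , i≢0 , i≢m) = innerDeg2 i i≢0 i≢m

  root-inner-neighbour : ∀ {y} → (G ∼ U 0) y → Inner u y → y ≡ U 1
  root-inner-neighbour U₀∼y y∈ with inner-index y∈
  ... | j , j+1<m , refl with inner-neighbours j+1<m (∼-sym G U₀∼y)
  ... | inj₁ U₀≡Uj  = cong (U ∘ suc) (sym (U-injective z≤n (≤-trans (n≤1+n j) (<⇒≤ j+1<m)) U₀≡Uj))
  ... | inj₂ U₀≡Uj+2 = contradiction (U-injective z≤n j+1<m U₀≡Uj+2) λ ()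

module Extension {n m} {G : SimpleGraph n} {u : Fin (suc m) → Fin n} (ear : Ear G m u)
  {φ : Coloring n} (φ-proper : Proper G φ) (φ-inner : ∀ x → Inner u x → φ x ≡ nothing)
  {c₀ c₁ t : Fin 4} (φu₀ : φ (u fzero) ≡ just c₀) (φuₘ : φ (u (fromℕ m)) ≡ just t) (c₀≢t : c₀ ≢ t)
  (c₁-root : RootColour c₀ t (nbrCount G φ (u fzero)) c₁) where

  open Ear ear using (length≥3; distinct)
  open EarPath ear
  open PathColouring c₀≢t (proj₁ c₁-root) (proj₁ (proj₂ c₁-root))

  extend : (x : Fin n) → Dec (Inner u x) → Maybe (Fin 4)
  extend _ (yes (i , _)) = just (colour (toℕ i))
  extend x (no _)        = φ x

  ψ : Coloring n
  ψ x = extend x (inner? x)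

  ψ-outer : ∀ x → ¬ Inner u x → ψ x ≡ φ x
  ψ-outer x x∉ with inner? x
  ... | yes x∈ = contradiction x∈ x∉
  ... | no _   = refl

  ψ-inner : ∀ {j} → suc j < m → ψ (U (suc j)) ≡ just (colour (suc j))
  ψ-inner {j} j+1<m with inner? (U (suc j))
  ... | yes (i , ui≡U , _) =
    cong (just ∘ colour) (trans (cong toℕ (distinct ui≡U)) (toℕ-mod (<⇒≤ j+1<m)))
  ... | no x∉              = contradiction (U-inner j+1<m) x∉

  ψ-coloured : ∀ x → Inner u x → ∃ λ c → ψ x ≡ just c
  ψ-coloured x x∈ with inner-index x∈
  ... | j , j+1<m , refl = colour (suc j) , ψ-inner j+1<m

  ψ-first : ψ (U 0) ≡ just c₀
  ψ-first = trans (ψ-outer _ ¬inner-first) φu₀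

  ψ-U : ∀ {j} → j < m → ψ (U j) ≡ just (colour j)
  ψ-U {zero}  _ = ψ-first
  ψ-U {suc j}   = ψ-inner

  ψ-next : ∀ {j} → suc j < m →
           ∃ λ c → ψ (U (suc (suc j))) ≡ just c × c ≢ colour (suc j) × c ≢ colour j
  ψ-next {j} j+1<m with m≤n⇒m<n∨m≡n j+1<m
  ... | inj₁ j+2<m = colour (suc (suc j)) , ψ-inner j+2<m , colour≢previous (suc j) , colour≢previous² j
  ... | inj₂ j+2≡m = t , ψ-last , ≢-sym (colour≢t (suc j)) , ≢-sym (colour≢t j)
    where
    ψ-last : ψ (U (suc (suc j))) ≡ just t
    ψ-last = trans (cong (ψ ∘ U) j+2≡m) (trans (ψ-outer _ ¬inner-last) (trans (cong φ U-last) φuₘ))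

  inner-proper : ∀ {x y c} → Inner u x → (G ∼ x) y → ψ x ≡ just c → ψ y ≢ just c
  inner-proper x∈ x∼y ψx ψy with inner-index x∈
  ... | j , j+1<m , refl with just-injective (trans (sym (ψ-inner j+1<m)) ψx) | inner-neighbours j+1<m x∼y
  ... | refl | inj₁ refl = colour≢previous j (just-injective (trans (sym ψy) (ψ-U (<⇒≤ j+1<m))))
  ... | refl | inj₂ refl with ψ-next j+1<m
  ...   | c , ψy≡c , c≢ , _ = c≢ (just-injective (trans (sym ψy≡c) ψy))

  ψ-proper : Proper G ψ
  ψ-proper x y c x∼y ψx ψy = by-cases (inner? x) (inner? y)
    where
    by-cases : Dec (Inner u x) → Dec (Inner u y) → ⊥
    by-cases (yes x∈) _        = inner-proper x∈ x∼y ψx ψy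
    by-cases (no _)   (yes y∈) = inner-proper y∈ (∼-sym G x∼y) ψy ψx
    by-cases (no x∉)  (no y∉)  =
      φ-proper x y c x∼y (trans (sym (ψ-outer x x∉)) ψx) (trans (sym (ψ-outer y y∉)) ψy)

  ψ-odd : ∀ {x} → Inner u x → OddCond G ψ x
  ψ-odd x∈ with inner-index x∈
  ... | j , j+1<m , refl with ψ-next j+1<m
  ...   | c , ψnext≡c , _ , c≢ =
    colour j , cong (_% 2) (nbrCount≡1 G ψ (λ _ → inner-neighbours j+1<m)
                                       (∼-sym G (U-adjacent (<⇒≤ j+1<m))) (ψ-U (<⇒≤ j+1<m))
                                       (c≢ ∘ just-injective ∘ trans (sym ψnext≡c)))

  ψ-root-count : ∀ k → nbrCount G ψ (U 0) k ≡ addColour c₁ (nbrCount G φ (U 0)) k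
  ψ-root-count k =
    nbrCount-fill G φ (U-adjacent (<⇒≤ length≥3)) (φ-inner _ (U-inner length≥3)) (ψ-inner length≥3) agree
    where
    agree : ∀ y → y ≢ U 1 → (G ∼ U 0) y → ψ y ≡ φ y
    agree y y≢U₁ U₀∼y = ψ-outer y (y≢U₁ ∘ root-inner-neighbour U₀∼y)

  ψ-root-parity : ∀ {v} → ParityCond G ψ v (U 0)
  ψ-root-parity = from-root c₁-root
    where
    from-root : ∀ {v} → RootColour c₀ t (nbrCount G φ (U 0)) c₁ → ParityCond G ψ v (U 0)
    from-root (_ , _ , (k , odd) , (k′ , k′≢c₀ , even)) =
      (k , trans (cong (_% 2) (ψ-root-count k)) odd) ,
      λ _ → k′ , k′≢c₀ ∘ sym ∘ just-injective ∘ trans (sym ψ-first) ,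
            trans (cong (_% 2) (ψ-root-count k′)) even

lemma4p1 : ∀ {n m} (G : SimpleGraph n) (pos : Fin n → Fin n)
    → OuterplanarWithOuterCycle G pos
    → (v : Fin n) (u : Fin (suc m) → Fin n)
    → Ear G m u
    → InOrderAlongF pos u
    → (InH u v → v ≡ u fzero)
    → (φ : Coloring n)
    → Proper G φ
    → (∀ x → Inner u x → φ x ≡ nothing)
    → (∃ λ c → φ (u fzero) ≡ just c)
    → (∃ λ c → φ (u (fromℕ m)) ≡ just c)
    → (∀ y → (G ∼ u fzero) y → ¬ Inner u y → ∃ λ c → φ y ≡ just c)
    → ∃ λ (ψ : Coloring n) →
        Proper G ψ
        × (∀ x → ¬ Inner u x → ψ x ≡ φ x)
        × (∀ x → Inner u x → ∃ λ c → ψ x ≡ just c)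
        × (∀ i → toℕ i ≢ m → ParityCond G ψ v (u i))
lemma4p1 {m = m} G _ _ v u ear _ v∈H⇒v≡u₀ φ φ-proper φ-inner (c₀ , φu₀) (t , φuₘ) _ =
  ψ , ψ-proper , ψ-outer , ψ-coloured , parity
  where
  open Ear ear using (rootEdge; distinct)
  c₀≢t : c₀ ≢ t
  c₀≢t c₀≡t = φ-proper _ _ c₀ rootEdge φu₀ (trans φuₘ (cong just (sym c₀≡t)))
  open Extension ear φ-proper φ-inner φu₀ φuₘ c₀≢t
                 (proj₂ (root-colour (nbrCount G φ (u fzero)) c₀ t c₀≢t))
  parity : ∀ i → toℕ i ≢ m → ParityCond G ψ v (u i)
  parity fzero   _   = ψ-root-parity
  parity (suc i) i≢m = ψ-odd (suc i , refl , (λ ()) , i≢m) ,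
    λ ui≡v → contradiction (distinct (trans ui≡v (v∈H⇒v≡u₀ (suc i , ui≡v)))) λ ()
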